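{- Let $K$ be a non-archimedean ordered field and $\sigma$ an order preserving field automorphism of $K$ which is $\omega$-increasing, i.e. $\sigma(a)>a^n$ for all $n\in\mathbb{N}_0$ and all $a\in\mathbf{P}_K$. Then $\mathcal{R}_\sigma\cap\mathcal{R}^{\rm pr}=\emptyset$.
   Context: $v$ is the natural valuation of $K$, with valuation ring $R_v$ the convex hull of $\mathbb{Q}$ in $K$; $\mathbf{P}_K:=K^{>0}\setminus R_v$. A valuation $w$ is convex if $a\ge b>0\Rightarrow w(a)\le w(b)$, and $\sigma$-compatible if $w(a)\le w(b)\iff w(\sigma(a))\le w(\sigma(b))$ for all $a,b\in K$. $\mathcal{R}$: valuation rings of convex valuations $w$ with $R_w\ne R_v$; $\mathcal{R}_\sigma$: those with $w$ $\sigma$-compatible; $\mathcal{R}^{\rm pr}$: those $R_w\in\mathcal{R}$ which are the smallest convex subring of $K$ containing some $a\in\mathbf{P}_K$. -}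

module Defs where

open import Data.Nat using (ℕ; zero; suc)
open import Data.Product using (Σ; ∃; _×_; _,_)
open import Data.Sum using (_⊎_)
open import Relation.Nullary using (¬_)
open import Relation.Binary.PropositionalEquality using (_≡_; _≢_)
open import Algebra.Structures using (IsCommutativeRing; IsAbelianGroup)
open import Relation.Binary.Structures using (IsTotalOrder)

record OrderedField : Set₁ where
  infixl 6 _+_
  infixl 7 _*_
  infix 4 _<_
  field
    Carrier : Set
    _+_ _*_ : Carrier → Carrier → Carrier
    -_      : Carrier → Carrier
    0# 1#   : Carrier
    isCommutativeRing : IsCommutativeRing _≡_ _+_ _*_ -_ 0# 1#
    0≢1     : 0# ≢ 1#
    inverse : ∀ x → x ≢ 0# → Σ Carrier (λ y → x * y ≡ 1#)
    _<_     : Carrier → Carrier → Set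
    <-irrefl : ∀ x → ¬ (x < x)
    <-trans  : ∀ {x y z} → x < y → y < z → x < z
    <-tri    : ∀ x y → x < y ⊎ (x ≡ y ⊎ y < x)
    <-+      : ∀ {x y} z → x < y → x + z < y + z
    <-*      : ∀ {x y} → 0# < x → 0# < y → 0# < x * y

  infix 4 _≤_
  _≤_ : Carrier → Carrier → Set
  x ≤ y = x < y ⊎ x ≡ y

  fromℕ : ℕ → Carrier
  fromℕ zero    = 0#
  fromℕ (suc n) = 1# + fromℕ n

  _^_ : Carrier → ℕ → Carrier
  a ^ zero  = 1#
  a ^ suc n = a * (a ^ n)

  Subset : Set₁
  Subset = Carrier → Set

  _≐_ : Subset → Subset → Set
  S ≐ T = ∀ a → (S a → T a) × (T a → S a)

  NonArchimedean : Set
  NonArchimedean = ∃ λ a → ∀ n → fromℕ n < a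

  -- R_v : the convex hull of ℚ in K (equivalently of ℤ), i.e.
  -- the elements bounded in absolute value by a natural number
  Rv : Subset
  Rv a = ∃ λ n → (- fromℕ n ≤ a) × (a ≤ fromℕ n)

  PK : Subset
  PK a = (0# < a) × ¬ Rv a

  record IsConvexSubring (S : Subset) : Set where
    field
      has-0 : S 0#
      has-1 : S 1#
      +-closed : ∀ {a b} → S a → S b → S (a + b)
      *-closed : ∀ {a b} → S a → S b → S (a * b)
      neg-closed : ∀ {a} → S a → S (- a)
      convex : ∀ {a b} → S a → 0# ≤ b → b ≤ a → S b

  IsSmallestConvexSubringContaining : Subset → Carrier → Set₁
  IsSmallestConvexSubringContaining S a =
    IsConvexSubring S × S a ×
    ((T : Subset) → IsConvexSubring T → T a → ∀ b → S b → T b)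

  record IsOrderPreservingAutomorphism (σ : Carrier → Carrier) : Set where
    field
      pres-+ : ∀ a b → σ (a + b) ≡ σ a + σ b
      pres-* : ∀ a b → σ (a * b) ≡ σ a * σ b
      pres-1 : σ 1# ≡ 1#
      injective  : ∀ {a b} → σ a ≡ σ b → a ≡ b
      surjective : ∀ b → ∃ λ a → σ a ≡ b
      pres-<     : ∀ {a b} → a < b → σ a < σ b

  OmegaIncreasing : (Carrier → Carrier) → Set
  OmegaIncreasing σ = ∀ a → PK a → ∀ n → (a ^ n) < σ a

record OrderedAbelianGroup : Set₁ where
  infixl 6 _∙_
  infix 4 _≤_
  field
    Carrier : Set
    _∙_ : Carrier → Carrier → Carrier
    ε   : Carrier
    _⁻¹ : Carrier → Carrier
    isAbelianGroup : IsAbelianGroup _≡_ _∙_ ε _⁻¹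
    _≤_ : Carrier → Carrier → Set
    isTotalOrder : IsTotalOrder _≡_ _≤_
    ≤-translation : ∀ {x y} z → x ≤ y → x ∙ z ≤ y ∙ z

module _ (Γ : OrderedAbelianGroup) where
  open OrderedAbelianGroup Γ

  data Γ∞ : Set where
    fin : Carrier → Γ∞
    ∞   : Γ∞

  infix 4 _≤∞_
  data _≤∞_ : Γ∞ → Γ∞ → Set where
    fin≤fin : ∀ {x y} → x ≤ y → fin x ≤∞ fin y
    _≤∞     : ∀ x → x ≤∞ ∞

  _⊕_ : Γ∞ → Γ∞ → Γ∞
  fin x ⊕ fin y = fin (x ∙ y)
  fin x ⊕ ∞     = ∞
  ∞     ⊕ y     = ∞

module _ (K : OrderedField) where
  private module K = OrderedField K

  record Valuation (Γ : OrderedAbelianGroup) : Set where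
    open OrderedAbelianGroup Γ using (ε)
    field
      w : K.Carrier → Γ∞ Γ
      w-∞→0 : ∀ a → w a ≡ ∞ → a ≡ K.0#
      w-0   : w K.0# ≡ ∞
      w-*   : ∀ a b → w (a K.* b) ≡ _⊕_ Γ (w a) (w b)
      w-+   : ∀ a b → _≤∞_ Γ (w a) (w (a K.+ b)) ⊎ _≤∞_ Γ (w b) (w (a K.+ b))

    R : K.Subset
    R a = _≤∞_ Γ (fin ε) (w a)

    IsConvex : Set
    IsConvex = ∀ a b → K.0# K.< b → b K.≤ a → _≤∞_ Γ (w a) (w b)

    IsCompatible : (K.Carrier → K.Carrier) → Set
    IsCompatible σ = ∀ a b → (_≤∞_ Γ (w a) (w b) → _≤∞_ Γ (w (σ a)) (w (σ b)))
                           × (_≤∞_ Γ (w (σ a)) (w (σ b)) → _≤∞_ Γ (w a) (w b))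

  In𝓡 : K.Subset → Set₁
  In𝓡 S = Σ OrderedAbelianGroup λ Γ → Σ (Valuation Γ) λ v →
            Valuation.IsConvex v × K._≐_ (Valuation.R v) S × ¬ K._≐_ (Valuation.R v) K.Rv

  In𝓡σ : (K.Carrier → K.Carrier) → K.Subset → Set₁
  In𝓡σ σ S = Σ OrderedAbelianGroup λ Γ → Σ (Valuation Γ) λ v →
            Valuation.IsConvex v × Valuation.IsCompatible v σ ×
            K._≐_ (Valuation.R v) S × ¬ K._≐_ (Valuation.R v) K.Rv

  In𝓡pr : K.Subset → Set₁
  In𝓡pr S = In𝓡 S × Σ K.Carrier λ a → K.PK a × K.IsSmallestConvexSubringContaining S a

-- The convex subring generated by a ∈ P_K consists of the elements bounded by
-- powers of a. If w is σ-compatible then σ(R_w) ⊆ R_w, since w(1) ≤ w(a) gives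
-- w(1) = w(σ 1) ≤ w(σ a). So if R_w were generated by some a ∈ P_K, the element
-- σ a would be bounded by a power of a, which ω-increase forbids.
module Submission where

open import Defs
open import Data.Product using (∃; _×_; _,_; proj₁; proj₂)
open import Data.Sum using (inj₁; inj₂)
open import Data.Empty using (⊥-elim)
open import Data.Nat as ℕ using (ℕ; zero; suc)
import Data.Nat.Properties as ℕ
open import Data.Maybe using (nothing)
open import Relation.Nullary using (¬_)
open import Relation.Binary.Bundles using (StrictPartialOrder)
open import Relation.Binary.PropositionalEquality
open import Algebra.Bundles using (CommutativeRing; Group)
open import Algebra.Structures using (IsCommutativeRing; IsAbelianGroup)
open import Tactic.RingSolver.Core.AlmostCommutativeRing
  using (AlmostCommutativeRing; fromCommutativeRing)

module OrderedFieldProperties (K : OrderedField) where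
  open OrderedField K
  open IsCommutativeRing isCommutativeRing
    using (+-assoc; +-comm; +-identityˡ; +-identityʳ; -‿inverseˡ; -‿inverseʳ;
           *-assoc; *-comm; *-identityˡ; *-identityʳ; zeroˡ; zeroʳ; distribʳ)

  commutativeRing : CommutativeRing _ _
  commutativeRing = record { isCommutativeRing = isCommutativeRing }

  open import Algebra.Properties.Ring (CommutativeRing.ring commutativeRing)
    using (-‿involutive; -‿distribˡ-*; -‿distribʳ-*; x[y-z]≈xy-xz)

  almostCommutativeRing : AlmostCommutativeRing _ _
  almostCommutativeRing = fromCommutativeRing commutativeRing (λ _ → nothing)

  open import Tactic.RingSolver.NonReflective almostCommutativeRing
    using (solve; _⊜_) renaming (_⊕_ to _⊞_; _⊗_ to _⊠_)

  <-strictPartialOrder : StrictPartialOrder _ _ _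
  <-strictPartialOrder = record
    { isStrictPartialOrder = record
      { isEquivalence = isEquivalence
      ; irrefl = λ { {x} refl → <-irrefl x }
      ; trans = <-trans
      ; <-resp-≈ = resp₂ _<_
      }
    }

  open import Relation.Binary.Reasoning.StrictPartialOrder <-strictPartialOrder

  ≤-trans : ∀ {x y z} → x ≤ y → y ≤ z → x ≤ z
  ≤-trans {x} {y} {z} x≤y y≤z = begin x ≤⟨ x≤y ⟩ y ≤⟨ y≤z ⟩ z ∎

  +-monoˡ-≤ : ∀ {x y} z → x ≤ y → x + z ≤ y + z
  +-monoˡ-≤ z (inj₁ x<y) = inj₁ (<-+ z x<y)
  +-monoˡ-≤ z (inj₂ refl) = inj₂ refl

  +-mono-≤ : ∀ {x y u v} → x ≤ y → u ≤ v → x + u ≤ y + v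
  +-mono-≤ {x} {y} {u} {v} x≤y u≤v = begin
    x + u  ≤⟨ +-monoˡ-≤ u x≤y ⟩
    y + u  ≡⟨ +-comm y u ⟩
    u + y  ≤⟨ +-monoˡ-≤ y u≤v ⟩
    v + y  ≡⟨ +-comm v y ⟩
    y + v  ∎

  x≤x+y : ∀ {x y} → 0# ≤ y → x ≤ x + y
  x≤x+y {x} {y} 0≤y = subst₂ _≤_ (+-identityˡ x) (+-comm y x) (+-monoˡ-≤ x 0≤y)

  y-x+x≡y : ∀ x y → (y + - x) + x ≡ y
  y-x+x≡y x y = begin-equality
    (y + - x) + x  ≡⟨ +-assoc y (- x) x ⟩
    y + (- x + x)  ≡⟨ cong (y +_) (-‿inverseˡ x) ⟩
    y + 0#         ≡⟨ +-identityʳ y ⟩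
    y              ∎

  x<y⇒0<y-x : ∀ {x y} → x < y → 0# < y + - x
  x<y⇒0<y-x {x} x<y = subst₂ _<_ (-‿inverseʳ x) refl (<-+ (- x) x<y)

  0<y-x⇒x<y : ∀ {x y} → 0# < y + - x → x < y
  0<y-x⇒x<y {x} {y} 0<y-x = subst₂ _<_ (+-identityˡ x) (y-x+x≡y x y) (<-+ x 0<y-x)

  x<0⇒0<-x : ∀ {x} → x < 0# → 0# < - x
  x<0⇒0<-x {x} x<0 = subst (0# <_) (+-identityˡ (- x)) (x<y⇒0<y-x x<0)

  -x*-x≡x*x : ∀ x → - x * - x ≡ x * x
  -x*-x≡x*x x = begin-equality
    - x * - x    ≡⟨ -‿distribˡ-* x (- x) ⟨
    - (x * - x)  ≡⟨ cong -_ (-‿distribʳ-* x x) ⟨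
    - - (x * x)  ≡⟨ -‿involutive (x * x) ⟩
    x * x        ∎

  0≤x*x : ∀ x → 0# ≤ x * x
  0≤x*x x with <-tri 0# x
  ... | inj₁ 0<x = inj₁ (<-* 0<x 0<x)
  ... | inj₂ (inj₁ refl) = inj₂ (sym (zeroˡ 0#))
  ... | inj₂ (inj₂ x<0) = inj₁ (subst (0# <_) (-x*-x≡x*x x) (<-* 0<-x 0<-x))
    where
    0<-x : 0# < - x
    0<-x = x<0⇒0<-x x<0

  0<1 : 0# < 1#
  0<1 with 0≤x*x 1#
  ... | inj₁ 0<1*1 = subst (0# <_) (*-identityˡ 1#) 0<1*1
  ... | inj₂ 0≡1*1 = ⊥-elim (0≢1 (trans 0≡1*1 (*-identityˡ 1#)))

  *-monoʳ-< : ∀ {c x y} → 0# < c → x < y → c * x < c * y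
  *-monoʳ-< {c} {x} {y} 0<c x<y =
    0<y-x⇒x<y (subst (0# <_) (x[y-z]≈xy-xz c y x) (<-* 0<c (x<y⇒0<y-x x<y)))

  *-monoʳ-≤ : ∀ {c x y} → 0# ≤ c → x ≤ y → c * x ≤ c * y
  *-monoʳ-≤ (inj₁ 0<c) (inj₁ x<y) = inj₁ (*-monoʳ-< 0<c x<y)
  *-monoʳ-≤ (inj₁ 0<c) (inj₂ refl) = inj₂ refl
  *-monoʳ-≤ {x = x} {y} (inj₂ refl) _ = inj₂ (trans (zeroˡ x) (sym (zeroˡ y)))

  *-self-mono-≤ : ∀ {x y} → 0# ≤ x → x ≤ y → x * x ≤ y * y
  *-self-mono-≤ {x} {y} 0≤x x≤y = begin
    x * x  ≤⟨ *-monoʳ-≤ 0≤x x≤y ⟩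
    x * y  ≡⟨ *-comm x y ⟩
    y * x  ≤⟨ *-monoʳ-≤ (≤-trans 0≤x x≤y) x≤y ⟩
    y * y  ∎

  -- The solver cannot cancel y + - y (it has no zero test on coefficients),
  -- so expand abstracts - y as a variable d.
  [x+y]²≤2[x²+y²] : ∀ x y → (x + y) * (x + y) ≤ (x * x + y * y) + (x * x + y * y)
  [x+y]²≤2[x²+y²] x y = begin
    (x + y) * (x + y)                                    ≤⟨ x≤x+y (0≤x*x (x + - y)) ⟩
    (x + y) * (x + y) + (x + - y) * (x + - y)            ≡⟨ expand x y (- y) ⟩
    (x² + y²) + (x² + - y * - y) + (x * (y + - y) + x * (y + - y))
                                                         ≡⟨ cong₂ (λ s t → (x² + y²) + (x² + s) + (x * t + x * t))
                                                                  (-x*-x≡x*x y) (-‿inverseʳ y) ⟩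
    (x² + y²) + (x² + y²) + (x * 0# + x * 0#)            ≡⟨ cong (λ t → (x² + y²) + (x² + y²) + (t + t)) (zeroʳ x) ⟩
    (x² + y²) + (x² + y²) + (0# + 0#)                    ≡⟨ cong ((x² + y²) + (x² + y²) +_) (+-identityʳ 0#) ⟩
    (x² + y²) + (x² + y²) + 0#                           ≡⟨ +-identityʳ _ ⟩
    (x² + y²) + (x² + y²)                                ∎
    where
    x² y² : Carrier
    x² = x * x
    y² = y * y
    expand : ∀ x y d → (x + y) * (x + y) + (x + d) * (x + d)
                     ≡ ((x * x + y * y) + (x * x + d * d)) + (x * (y + d) + x * (y + d))
    expand = solve 3 (λ x y d →
      ((x ⊞ y) ⊠ (x ⊞ y) ⊞ (x ⊞ d) ⊠ (x ⊞ d))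
      ⊜ (((x ⊠ x ⊞ y ⊠ y) ⊞ (x ⊠ x ⊞ d ⊠ d)) ⊞ (x ⊠ (y ⊞ d) ⊞ x ⊠ (y ⊞ d)))) refl

  fromℕ-suc-* : ∀ n x → fromℕ (suc n) * x ≡ x + fromℕ n * x
  fromℕ-suc-* n x = trans (distribʳ x 1# (fromℕ n)) (cong (_+ fromℕ n * x) (*-identityˡ x))

  2*x≡x+x : ∀ x → fromℕ 2 * x ≡ x + x
  2*x≡x+x x = begin-equality
    fromℕ 2 * x          ≡⟨ fromℕ-suc-* 1 x ⟩
    x + fromℕ 1 * x      ≡⟨ cong (x +_) (fromℕ-suc-* 0 x) ⟩
    x + (x + 0# * x)     ≡⟨ cong (λ t → x + (x + t)) (zeroˡ x) ⟩
    x + (x + 0#)         ≡⟨ cong (x +_) (+-identityʳ x) ⟩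
    x + x                ∎

  1<2 : 1# < fromℕ 2
  1<2 = subst₂ _<_ (trans (+-identityˡ (fromℕ 1)) (+-identityʳ 1#)) refl (<-+ (fromℕ 1) 0<1)

  0≤fromℕ : ∀ n → 0# ≤ fromℕ n
  0≤fromℕ zero = inj₂ refl
  0≤fromℕ (suc n) = inj₁ (begin-strict
    0#             ≡⟨ +-identityˡ 0# ⟨
    0# + 0#        <⟨ <-+ 0# 0<1 ⟩
    1# + 0#        ≡⟨ +-comm 1# 0# ⟩
    0# + 1#        ≤⟨ +-mono-≤ (0≤fromℕ n) (inj₂ refl) ⟩
    fromℕ n + 1#   ≡⟨ +-comm (fromℕ n) 1# ⟩
    fromℕ (suc n)  ∎)

  0≤x⇒-x≤0 : ∀ {x} → 0# ≤ x → - x ≤ 0#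
  0≤x⇒-x≤0 {x} 0≤x = subst₂ _≤_ (+-identityˡ (- x)) (-‿inverseʳ x) (+-monoˡ-≤ (- x) 0≤x)

  -fromℕ<pos : ∀ {a} n → 0# < a → - fromℕ n < a
  -fromℕ<pos {a} n 0<a = begin-strict - fromℕ n ≤⟨ 0≤x⇒-x≤0 (0≤fromℕ n) ⟩ 0# <⟨ 0<a ⟩ a ∎

  PK⇒fromℕ< : ∀ {a} → PK a → ∀ n → fromℕ n < a
  PK⇒fromℕ< {a} (0<a , a∉Rv) n with <-tri (fromℕ n) a
  ... | inj₁ n<a = n<a
  ... | inj₂ (inj₁ n≡a) = ⊥-elim (a∉Rv (n , inj₁ (-fromℕ<pos n 0<a) , inj₂ (sym n≡a)))
  ... | inj₂ (inj₂ a<n) = ⊥-elim (a∉Rv (n , inj₁ (-fromℕ<pos n 0<a) , inj₁ a<n))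

  ^-+ : ∀ a m n → a ^ m * a ^ n ≡ a ^ (m ℕ.+ n)
  ^-+ a zero    n = *-identityˡ (a ^ n)
  ^-+ a (suc m) n = trans (*-assoc a (a ^ m) (a ^ n)) (cong (a *_) (^-+ a m n))

  -- |b| ≤ a ^ n for some n, stated with squares to avoid |_|.
  BoundedByPowerOf : Carrier → Subset
  BoundedByPowerOf a b = ∃ λ n → b * b ≤ a ^ n

  BoundedByPowerOf-self : ∀ a → BoundedByPowerOf a a
  BoundedByPowerOf-self a = 2 , inj₂ (cong (a *_) (sym (*-identityʳ a)))

  ¬BoundedByPowerOf : ∀ {a s} → (∀ n → a ^ n < s) → ¬ BoundedByPowerOf a s
  ¬BoundedByPowerOf {a} {s} a^n<s (n , s²≤a^n) = <-irrefl s (begin-strict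
    s          ≡⟨ *-identityʳ s ⟨
    s * 1#     <⟨ *-monoʳ-< 0<s (a^n<s 0) ⟩
    s * s      ≤⟨ s²≤a^n ⟩
    a ^ n      <⟨ a^n<s n ⟩
    s          ∎)
    where
    0<s : 0# < s
    0<s = <-trans 0<1 (a^n<s 0)

  module _ {a} (2<a : fromℕ 2 < a) where

    1<a : 1# < a
    1<a = <-trans 1<2 2<a

    0<a : 0# < a
    0<a = <-trans 0<1 1<a

    0<a^n : ∀ n → 0# < a ^ n
    0<a^n zero    = 0<1
    0<a^n (suc n) = <-* 0<a (0<a^n n)

    a^n≤a^[m+n] : ∀ m n → a ^ n ≤ a ^ (m ℕ.+ n)
    a^n≤a^[m+n] zero    n = inj₂ refl
    a^n≤a^[m+n] (suc m) n = inj₁ (begin-strict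
      a ^ n              ≤⟨ a^n≤a^[m+n] m n ⟩
      a ^ (m ℕ.+ n)      ≡⟨ *-identityʳ _ ⟨
      a ^ (m ℕ.+ n) * 1# <⟨ *-monoʳ-< (0<a^n (m ℕ.+ n)) 1<a ⟩
      a ^ (m ℕ.+ n) * a  ≡⟨ *-comm _ a ⟩
      a ^ suc (m ℕ.+ n)  ∎)

    x+x<a*x : ∀ {x} → 0# < x → x + x < a * x
    x+x<a*x {x} 0<x = begin-strict
      x + x        ≡⟨ 2*x≡x+x x ⟨
      fromℕ 2 * x  ≡⟨ *-comm _ x ⟩
      x * fromℕ 2  <⟨ *-monoʳ-< 0<x 2<a ⟩
      x * a        ≡⟨ *-comm x a ⟩
      a * x        ∎

    BoundedByPowerOf-+ : ∀ {b c} → BoundedByPowerOf a b → BoundedByPowerOf a c → BoundedByPowerOf a (b + c)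
    BoundedByPowerOf-+ {b} {c} (m , b²≤a^m) (n , c²≤a^n) = suc (suc k) , inj₁ (begin-strict
      (b + c) * (b + c)                 ≤⟨ [x+y]²≤2[x²+y²] b c ⟩
      (b * b + c * c) + (b * b + c * c) ≤⟨ +-mono-≤ b²+c²≤A+A b²+c²≤A+A ⟩
      (A + A) + (A + A)                 <⟨ x+x<a*x 0<A+A ⟩
      a * (A + A)                       <⟨ *-monoʳ-< 0<a (x+x<a*x (0<a^n k)) ⟩
      a * (a * A)                       ∎)
      where
      k : ℕ
      k = m ℕ.+ n
      A : Carrier
      A = a ^ k
      0<A+A : 0# < A + A
      0<A+A = begin-strict 0# <⟨ 0<a^n k ⟩ A ≤⟨ x≤x+y (inj₁ (0<a^n k)) ⟩ A + A ∎
      b²+c²≤A+A : b * b + c * c ≤ A + A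
      b²+c²≤A+A = +-mono-≤ (≤-trans b²≤a^m (subst (λ i → a ^ m ≤ a ^ i) (ℕ.+-comm n m) (a^n≤a^[m+n] n m)))
                           (≤-trans c²≤a^n (a^n≤a^[m+n] m n))

    BoundedByPowerOf-* : ∀ {b c} → BoundedByPowerOf a b → BoundedByPowerOf a c → BoundedByPowerOf a (b * c)
    BoundedByPowerOf-* {b} {c} (m , b²≤a^m) (n , c²≤a^n) = m ℕ.+ n , (begin
      (b * c) * (b * c)   ≡⟨ solve 2 (λ b c → ((b ⊠ c) ⊠ (b ⊠ c)) ⊜ ((b ⊠ b) ⊠ (c ⊠ c))) refl b c ⟩
      (b * b) * (c * c)   ≤⟨ *-monoʳ-≤ (0≤x*x b) c²≤a^n ⟩
      (b * b) * a ^ n     ≡⟨ *-comm _ (a ^ n) ⟩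
      a ^ n * (b * b)     ≤⟨ *-monoʳ-≤ (inj₁ (0<a^n n)) b²≤a^m ⟩
      a ^ n * a ^ m       ≡⟨ *-comm (a ^ n) (a ^ m) ⟩
      a ^ m * a ^ n       ≡⟨ ^-+ a m n ⟩
      a ^ (m ℕ.+ n)       ∎)

    BoundedByPowerOf-isConvexSubring : IsConvexSubring (BoundedByPowerOf a)
    BoundedByPowerOf-isConvexSubring = record
      { has-0 = 0 , inj₁ (subst (_< 1#) (sym (zeroˡ 0#)) 0<1)
      ; has-1 = 0 , inj₂ (*-identityˡ 1#)
      ; +-closed = BoundedByPowerOf-+
      ; *-closed = BoundedByPowerOf-*
      ; neg-closed = λ { {b} (n , b²≤a^n) → n , subst (_≤ a ^ n) (sym (-x*-x≡x*x b)) b²≤a^n }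
      ; convex = λ { (n , b²≤a^n) 0≤c c≤b → n , ≤-trans (*-self-mono-≤ 0≤c c≤b) b²≤a^n }
      }

module ValuationProperties {K : OrderedField} {Γ : OrderedAbelianGroup} (v : Valuation K Γ) where
  open OrderedField K using (1#; 0≢1; _*_)
  open IsCommutativeRing (OrderedField.isCommutativeRing K) using (*-identityˡ)
  open OrderedAbelianGroup Γ using (_∙_; ε; isAbelianGroup)
  open Valuation v

  group : Group _ _
  group = record { isGroup = IsAbelianGroup.isGroup isAbelianGroup }

  open import Algebra.Properties.Group group using (identityˡ-unique)

  w-1 : w 1# ≡ fin ε
  w-1 with w 1# in w1≡
  ... | ∞ = ⊥-elim (0≢1 (sym (w-∞→0 1# w1≡)))
  ... | fin x = cong fin (identityˡ-unique x x (fin-injective (begin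
    fin (x ∙ x)          ≡⟨ cong₂ (_⊕_ Γ) w1≡ w1≡ ⟨
    _⊕_ Γ (w 1#) (w 1#)  ≡⟨ w-* 1# 1# ⟨
    w (1# * 1#)          ≡⟨ cong w (*-identityˡ 1#) ⟩
    w 1#                 ≡⟨ w1≡ ⟩
    fin x                ∎)))
    where
    open ≡-Reasoning
    fin-injective : ∀ {x y} → fin {Γ} x ≡ fin y → x ≡ y
    fin-injective refl = refl

  R-σ-closed : ∀ {σ} → σ 1# ≡ 1# → IsCompatible σ → ∀ {a} → R a → R (σ a)
  R-σ-closed {σ} σ1≡1 compatible {a} a∈R =
    subst (λ u → _≤∞_ Γ u (w (σ a))) (trans (cong w σ1≡1) w-1)
      (proj₁ (compatible 1# a) (subst (λ u → _≤∞_ Γ u (w a)) (sym w-1) a∈R))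

corollary4p7 : (K : OrderedField) → OrderedField.NonArchimedean K →
    (σ : OrderedField.Carrier K → OrderedField.Carrier K) →
    OrderedField.IsOrderPreservingAutomorphism K σ →
    OrderedField.OmegaIncreasing K σ →
    (S : OrderedField.Subset K) → ¬ (In𝓡σ K σ S × In𝓡pr K S)
corollary4p7 K _ σ σ-aut ω-increasing S
  ((Γ , v , _ , compatible , R≐S , _) , (_ , a , a∈PK , (_ , a∈S , S-least))) =
  ¬BoundedByPowerOf (ω-increasing a a∈PK) (S⊆bounded (σ a) σa∈S)
  where
  open OrderedField K using (IsOrderPreservingAutomorphism)
  open OrderedFieldProperties K
  open IsOrderPreservingAutomorphism σ-aut using (pres-1)
  open ValuationProperties v using (R-σ-closed)

  S⊆bounded : ∀ b → S b → BoundedByPowerOf a b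
  S⊆bounded = S-least (BoundedByPowerOf a)
    (BoundedByPowerOf-isConvexSubring (PK⇒fromℕ< a∈PK 2)) (BoundedByPowerOf-self a)

  σa∈S : S (σ a)
  σa∈S = proj₁ (R≐S (σ a)) (R-σ-closed pres-1 compatible (proj₂ (R≐S a) a∈S))
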